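{- For $n\ge0$ let $(q)_n:=\prod_{k=1}^n(1-q^k)$ (with $(q)_0=1$). For a positive integer $a$ define formal power series \[B_a(q):=\sum_{n=1}^{\infty}\frac{q^{n^2+an}}{(q)_n^2}=:\sum_{N=1}^\infty b_a(N)q^N,\qquad \widehat{B}_a(q):=\sum_{n=1}^{\infty}\frac{q^{n^2+an}}{(q)_n^2(1-q^{an})}=:\sum_{N=1}^\infty \widehat{b}_a(N)q^N.\] Then for every positive integer $a$ and every $n$, \[\widehat{b}_a(n)=\sum_{j=1}^\infty b_{aj}(n).\] Moreover, with $\mu$ the classical M\"obius function, \[B_a(q)=\sum_{n=1}^\infty \mu(n)\widehat{B}_{an}(q),\qquad b_a(n)=\sum_{j=1}^\infty\mu(j)\widehat{b}_{aj}(n).\] -}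

module Defs where

open import Data.Nat as ℕ using (ℕ; zero; suc; _<_; _≤_; _^_)
open import Data.Nat.Divisibility using (_∣?_)
open import Data.Nat.Primality using (prime?)
open import Data.Integer as ℤ using (ℤ; +_; -_; _+_; _*_)
open import Data.Bool using (Bool; true; false; if_then_else_; _∨_)
open import Data.Product using (Σ; _×_)
open import Relation.Nullary.Decidable using (⌊_⌋)
open import Relation.Binary.PropositionalEquality using (_≡_)

sum1 : ℕ → (ℕ → ℤ) → ℤ
sum1 zero    f = + 0
sum1 (suc m) f = sum1 m f + f (suc m)

sum0 : ℕ → (ℕ → ℤ) → ℤ
sum0 zero    f = f 0
sum0 (suc m) f = sum0 m f + f (suc m)

-- Formal power series over ℤ, as coefficient sequences (coefficient of q^N).
PS : Set
PS = ℕ → ℤ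

_⊛_ : PS → PS → PS
(f ⊛ g) N = sum0 N (λ i → f i * g (N ℕ.∸ i))

infixl 7 _⊛_

mono : ℕ → PS
mono m N = if ⌊ m ℕ.≟ N ⌋ then + 1 else + 0

-- 1/(1 - q^k) = Σ_{t≥0} q^{kt}, for k ≥ 1 (only used with k ≥ 1).
geom : ℕ → PS
geom k N = if ⌊ k ∣? N ⌋ then + 1 else + 0

invPoch : ℕ → PS
invPoch zero    = mono 0
invPoch (suc n) = invPoch n ⊛ geom (suc n)

termB : ℕ → ℕ → PS
termB a n = mono (n ℕ.* n ℕ.+ a ℕ.* n) ⊛ invPoch n ⊛ invPoch n

termBh : ℕ → ℕ → PS
termBh a n = termB a n ⊛ geom (a ℕ.* n)

-- b_a(N): coefficient of q^N in B_a = Σ_{n≥1} termB a n.  Summands with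
-- n > N have order n²+an > N, so the sum over n = 1..N is the full coefficient.
b : ℕ → ℕ → ℤ
b a N = sum1 N (λ n → termB a n N)

bh : ℕ → ℕ → ℤ
bh a N = sum1 N (λ n → termBh a n N)

hasSquareFactorUpTo : ℕ → ℕ → Bool
hasSquareFactorUpTo zero          n = false
hasSquareFactorUpTo (suc zero)    n = false
hasSquareFactorUpTo (suc (suc m)) n =
  hasSquareFactorUpTo (suc m) n ∨ ⌊ (suc (suc m) ℕ.* suc (suc m)) ∣? n ⌋

primeDivCountUpTo : ℕ → ℕ → ℕ
primeDivCountUpTo zero    n = 0
primeDivCountUpTo (suc m) n =
  primeDivCountUpTo m n ℕ.+ (if ⌊ prime? (suc m) ⌋ ∧' ⌊ suc m ∣? n ⌋ then 1 else 0)
  where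
  _∧'_ : Bool → Bool → Bool
  true ∧' y = y
  false ∧' y = false

-- Classical Möbius function (for n ≥ 1): μ(n) = 0 if n has a square factor
-- d² (d ≥ 2), else (-1)^k with k the number of distinct prime divisors.
-- (μ 0 = 0 by convention; never used.)
μ : ℕ → ℤ
μ zero = + 0
μ n@(suc _) =
  if hasSquareFactorUpTo n n then + 0
  else (if ⌊ 2 ∣? primeDivCountUpTo n n ⌋ then + 1 else - (+ 1))

-- Σ_{j=1}^{∞} f j = v : f is finitely supported on j ≥ 1 and its sum is v.
HasSum : (ℕ → ℤ) → ℤ → Set
HasSum f v = Σ ℕ (λ M → (∀ j → M < j → f j ≡ + 0) × (sum1 M f ≡ v))

-- Formal sum of power series Σ_{j=1}^{∞} F j = G (coefficientwise convergence).
PSHasSum : (ℕ → PS) → PS → Set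
PSHasSum F G = ∀ N → HasSum (λ j → F j N) (G N)

B : ℕ → PS
B = b

Bh : ℕ → PS
Bh = bh

module Submission where

-- The m-th summand of B̂_c is q^{m²+cm}/(q)_m²
-- times the geometric series 1/(1 - q^{cm}) = Σ_{t ≥ 0} q^{cmt}, so it equals the sum
-- over j ≥ 1 of the m-th summands q^{m²+cjm}/(q)_m² of B_{cj}; summing over m and
-- exchanging the two finite sums gives the first identity.  Used with c = a j it
-- says b̂_{aj}(n) = Σ_k b_{ajk}(n), and Möbius inversion Σ_j μ(j) Σ_k f(jk) = f(1),
-- applied to f(m) = b_{am}(n), gives the second.  Möbius inversion rests on
-- Σ_{d ∣ m} μ(d) = [m = 1], proved by pairing d with d p for a prime p ∣ m, using
-- μ(q p) = -μ(q) if p ∤ q and μ(q p) = 0 if p ∣ q, which we derive from the explicit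
-- formula for μ in Defs.  A coefficient of q^N involves only finitely many terms, so
-- all sums below are finite, over 0..L (sum0) or 1..L (sum1).

open import Defs
open import Data.Nat using (ℕ; zero; suc; _≤_; _<_; _*_; _+_; _∸_; z≤n; s≤s; _≤?_; _≟_; NonZero; >-nonZero; nonTrivial⇒n>1)
import Data.Nat.Properties as ℕP
open import Data.Nat.Divisibility
  using ( _∣_; _∣?_; divides; ∣-refl; ∣-trans; ∣⇒≤; ∣1⇒≡1; m∣m*n; n∣m*n; ∣m⇒∣m*n
        ; *-pres-∣; *-monoˡ-∣; *-cancelʳ-∣; ∣m+n∣m⇒∣n; ∣m∣n⇒∣m+n )
open import Data.Nat.Primality using (Prime; prime?; euclidsLemma; prime⇒irreducible; prime⇒nonTrivial; prime⇒nonZero)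
open import Data.Nat.Primality.Factorisation using (factorise)
open import Data.Nat.Coprimality using (Coprime; coprime-divisor)
import Data.Nat.Coprimality as Coprime
open import Data.Nat.Solver using (module +-*-Solver)
open import Data.Integer using (ℤ; +_) renaming (_*_ to _*ℤ_; _+_ to _+ℤ_; -_ to -ℤ_; _-_ to _-ℤ_)
import Data.Integer.Properties as ℤP
open import Algebra.Properties.CommutativeSemigroup ℤP.+-commutativeSemigroup using (interchange)
open import Algebra.Properties.CommutativeSemigroup ℕP.+-commutativeSemigroup using (xy∙z≈xz∙y)
open import Algebra.Properties.CommutativeSemigroup ℤP.*-commutativeSemigroup using (x∙yz≈y∙xz)
open import Data.Bool using (Bool; true; false; if_then_else_; _∨_; not)
import Data.Bool.Properties as BoolP
open import Data.List using ([]; _∷_)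
open import Data.List.Relation.Unary.All using (_∷_)
open import Data.Empty using (⊥-elim)
open import Data.Product using (Σ; _×_; _,_)
open import Data.Sum using (_⊎_; inj₁; inj₂; [_,_]′)
open import Function using (_∘_)
open import Relation.Nullary using (Dec; yes; no; ¬_; isYes)
open import Relation.Binary.PropositionalEquality

choose : ∀ {a p} {A : Set a} {P : Set p} → A → A → Dec P → A
choose x y d = if isYes d then x else y

choose-yes : ∀ {a p} {A : Set a} {P : Set p} {x y : A} (d : Dec P) → P → choose x y d ≡ x
choose-yes (yes _) _ = refl
choose-yes (no ¬p) p = ⊥-elim (¬p p)

choose-no : ∀ {a p} {A : Set a} {P : Set p} {x y : A} (d : Dec P) → ¬ P → choose x y d ≡ y
choose-no (yes p) ¬p = ⊥-elim (¬p p)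
choose-no (no _) _ = refl

choose-iff : ∀ {a p q} {A : Set a} {P : Set p} {Q : Set q} {x y : A} (d : Dec P) (e : Dec Q) →
             (P → Q) → (Q → P) → choose x y d ≡ choose x y e
choose-iff (yes p) (yes q) f g = refl
choose-iff (yes p) (no ¬q) f g = ⊥-elim (¬q (f p))
choose-iff (no ¬p) (yes q) f g = ⊥-elim (¬p (g q))
choose-iff (no ¬p) (no ¬q) f g = refl

-- The integer 0/1 indicator of a decidable proposition.  The series of Defs
-- are indicators on the nose: mono m N is 𝟙 (m ≟ N) and geom k N is 𝟙 (k ∣? N).
𝟙 : ∀ {p} {P : Set p} → Dec P → ℤ
𝟙 = choose (+ 1) (+ 0)

𝟙-unitˡ : ∀ {p} {P : Set p} (d : Dec P) x → P → 𝟙 d *ℤ x ≡ x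
𝟙-unitˡ d x p = trans (cong (_*ℤ x) (choose-yes d p)) (ℤP.*-identityˡ x)

𝟙-unitʳ : ∀ {p} {P : Set p} (d : Dec P) x → P → x *ℤ 𝟙 d ≡ x
𝟙-unitʳ d x p = trans (ℤP.*-comm x (𝟙 d)) (𝟙-unitˡ d x p)

𝟙-zeroˡ : ∀ {p} {P : Set p} (d : Dec P) x → ¬ P → 𝟙 d *ℤ x ≡ + 0
𝟙-zeroˡ d x ¬p = trans (cong (_*ℤ x) (choose-no d ¬p)) (ℤP.*-zeroˡ x)

𝟙-zeroʳ : ∀ {p} {P : Set p} (d : Dec P) x → ¬ P → x *ℤ 𝟙 d ≡ + 0
𝟙-zeroʳ d x ¬p = trans (ℤP.*-comm x (𝟙 d)) (𝟙-zeroˡ d x ¬p)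

Bool-ext : ∀ {x y : Bool} → (x ≡ true → y ≡ true) → (y ≡ true → x ≡ true) → x ≡ y
Bool-ext {false} {false} _ _ = refl
Bool-ext {false} {true}  _ g = g refl
Bool-ext {true}  {false} f _ = sym (f refl)
Bool-ext {true}  {true}  _ _ = refl

isYes-sound : ∀ {p} {P : Set p} (d : Dec P) → isYes d ≡ true → P
isYes-sound (yes p) _ = p

isYes-complete : ∀ {p} {P : Set p} (d : Dec P) → P → isYes d ≡ true
isYes-complete (yes _) _ = refl
isYes-complete (no ¬p) p = ⊥-elim (¬p p)

ι : ∀ {p} {P : Set p} → Dec P → ℕ
ι = choose 1 0

sum0-cong : ∀ L {f g : ℕ → ℤ} → (∀ i → i ≤ L → f i ≡ g i) → sum0 L f ≡ sum0 L g
sum0-cong zero    h = h 0 z≤n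
sum0-cong (suc L) h = cong₂ _+ℤ_ (sum0-cong L (λ i i≤L → h i (ℕP.m≤n⇒m≤1+n i≤L))) (h (suc L) ℕP.≤-refl)

sum0-zero : ∀ L {f : ℕ → ℤ} → (∀ i → i ≤ L → f i ≡ + 0) → sum0 L f ≡ + 0
sum0-zero L {f} h = trans (sum0-cong L h) (sum0-const L)
  where
  sum0-const : ∀ L → sum0 L (λ _ → + 0) ≡ + 0
  sum0-const zero    = refl
  sum0-const (suc L) = cong (_+ℤ + 0) (sum0-const L)

sum0-single : ∀ L x {f : ℕ → ℤ} → x ≤ L → (∀ i → i ≤ L → i ≢ x → f i ≡ + 0) → sum0 L f ≡ f x
sum0-single zero .zero z≤n h = refl
sum0-single (suc L) x {f} x≤L h with x ≟ suc L
... | yes refl = trans (cong (_+ℤ f x) (sum0-zero L (λ i i≤L → h i (ℕP.m≤n⇒m≤1+n i≤L) (ℕP.<⇒≢ (s≤s i≤L)))))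
                       (ℤP.+-identityˡ (f x))
... | no x≢L  = trans (cong₂ _+ℤ_ (sum0-single L x (ℕP.≤-pred (ℕP.≤∧≢⇒< x≤L x≢L))
                                                (λ i i≤L → h i (ℕP.m≤n⇒m≤1+n i≤L)))
                                  (h (suc L) ℕP.≤-refl (x≢L ∘ sym)))
                       (ℤP.+-identityʳ (f x))

sum0-+ : ∀ L (f g : ℕ → ℤ) → sum0 L (λ i → f i +ℤ g i) ≡ sum0 L f +ℤ sum0 L g
sum0-+ zero    f g = refl
sum0-+ (suc L) f g = trans (cong (_+ℤ (f (suc L) +ℤ g (suc L))) (sum0-+ L f g))
                           (interchange (sum0 L f) (sum0 L g) (f (suc L)) (g (suc L)))

sum0-*ˡ : ∀ L c (f : ℕ → ℤ) → c *ℤ sum0 L f ≡ sum0 L (λ i → c *ℤ f i)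
sum0-*ˡ zero    c f = refl
sum0-*ˡ (suc L) c f = trans (ℤP.*-distribˡ-+ c (sum0 L f) (f (suc L))) (cong (_+ℤ c *ℤ f (suc L)) (sum0-*ˡ L c f))

sum0-swap : ∀ A B (F : ℕ → ℕ → ℤ) → sum0 A (λ i → sum0 B (F i)) ≡ sum0 B (λ t → sum0 A (λ i → F i t))
sum0-swap zero    B F = refl
sum0-swap (suc A) B F = trans (cong (_+ℤ sum0 B (F (suc A))) (sum0-swap A B F))
                              (sym (sum0-+ B (λ t → sum0 A (λ i → F i t)) (F (suc A))))

sum0-suc : ∀ L (f : ℕ → ℤ) → sum0 (suc L) f ≡ f 0 +ℤ sum0 L (f ∘ suc)
sum0-suc zero    f = refl
sum0-suc (suc L) f = trans (cong (_+ℤ f (suc (suc L))) (sum0-suc L f))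
                           (ℤP.+-assoc (f 0) (sum0 L (f ∘ suc)) (f (suc (suc L))))

sum1-sum0 : ∀ L (f : ℕ → ℤ) → sum1 (suc L) f ≡ sum0 L (f ∘ suc)
sum1-sum0 zero    f = ℤP.+-identityˡ (f 1)
sum1-sum0 (suc L) f = cong (_+ℤ f (suc (suc L))) (sum1-sum0 L f)

sum1-cong : ∀ L {f g : ℕ → ℤ} → (∀ i → 1 ≤ i → i ≤ L → f i ≡ g i) → sum1 L f ≡ sum1 L g
sum1-cong zero    h = refl
sum1-cong (suc L) h = cong₂ _+ℤ_ (sum1-cong L (λ i 1≤i i≤L → h i 1≤i (ℕP.m≤n⇒m≤1+n i≤L)))
                                 (h (suc L) (s≤s z≤n) ℕP.≤-refl)

sum1-zero : ∀ L {f : ℕ → ℤ} → (∀ i → 1 ≤ i → i ≤ L → f i ≡ + 0) → sum1 L f ≡ + 0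
sum1-zero L {f} h = trans (sum1-cong L h) (sum1-const L)
  where
  sum1-const : ∀ L → sum1 L (λ _ → + 0) ≡ + 0
  sum1-const zero    = refl
  sum1-const (suc L) = cong (_+ℤ + 0) (sum1-const L)

sum1-single : ∀ L x {f : ℕ → ℤ} → 1 ≤ x → x ≤ L →
              (∀ i → 1 ≤ i → i ≤ L → i ≢ x → f i ≡ + 0) → sum1 L f ≡ f x
sum1-single zero .zero () z≤n h
sum1-single (suc L) x {f} 1≤x x≤L h with x ≟ suc L
... | yes refl = trans (cong (_+ℤ f x) (sum1-zero L (λ i 1≤i i≤L →
                                         h i 1≤i (ℕP.m≤n⇒m≤1+n i≤L) (ℕP.<⇒≢ (s≤s i≤L)))))
                       (ℤP.+-identityˡ (f x))
... | no x≢L  = trans (cong₂ _+ℤ_ (sum1-single L x 1≤x (ℕP.≤-pred (ℕP.≤∧≢⇒< x≤L x≢L))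
                                                (λ i 1≤i i≤L → h i 1≤i (ℕP.m≤n⇒m≤1+n i≤L)))
                                  (h (suc L) (s≤s z≤n) ℕP.≤-refl (x≢L ∘ sym)))
                       (ℤP.+-identityʳ (f x))

sum1-+ : ∀ L (f g : ℕ → ℤ) → sum1 L (λ i → f i +ℤ g i) ≡ sum1 L f +ℤ sum1 L g
sum1-+ zero    f g = refl
sum1-+ (suc L) f g = trans (cong (_+ℤ (f (suc L) +ℤ g (suc L))) (sum1-+ L f g))
                           (interchange (sum1 L f) (sum1 L g) (f (suc L)) (g (suc L)))

sum1-*ˡ : ∀ L c (f : ℕ → ℤ) → c *ℤ sum1 L f ≡ sum1 L (λ i → c *ℤ f i)
sum1-*ˡ zero    c f = ℤP.*-zeroʳ c
sum1-*ˡ (suc L) c f = trans (ℤP.*-distribˡ-+ c (sum1 L f) (f (suc L))) (cong (_+ℤ c *ℤ f (suc L)) (sum1-*ˡ L c f))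

sum1-neg : ∀ L (f : ℕ → ℤ) → sum1 L (λ i → -ℤ f i) ≡ -ℤ sum1 L f
sum1-neg zero    f = refl
sum1-neg (suc L) f = trans (cong (_+ℤ -ℤ f (suc L)) (sum1-neg L f)) (sym (ℤP.neg-distrib-+ (sum1 L f) (f (suc L))))

sum1-swap : ∀ A B (F : ℕ → ℕ → ℤ) → sum1 A (λ i → sum1 B (F i)) ≡ sum1 B (λ t → sum1 A (λ i → F i t))
sum1-swap zero    B F = sym (sum1-zero B (λ _ _ _ → refl))
sum1-swap (suc A) B F = trans (cong (_+ℤ sum1 B (F (suc A))) (sum1-swap A B F))
                              (sym (sum1-+ B (λ t → sum1 A (λ i → F i t)) (F (suc A))))

-- Multiplication by q^k: sh k f = q^k · f, i.e. (sh k f) N = [k ≤ N] f (N - k).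
sh : ℕ → PS → PS
sh k f N = 𝟙 (k ≤? N) *ℤ f (N ∸ k)

sh-vanish : ∀ k (f : PS) N → N < k → sh k f N ≡ + 0
sh-vanish k f N N<k = 𝟙-zeroˡ (k ≤? N) (f (N ∸ k)) (ℕP.<⇒≱ N<k)

sh-at : ∀ k (f : PS) L → sh k f (k + L) ≡ f L
sh-at k f L = trans (𝟙-unitˡ (k ≤? k + L) _ (ℕP.m≤m+n k L)) (cong f (ℕP.m+n∸m≡n k L))

sh-+ : ∀ k x y (f : PS) → sh (k + x) f (k + y) ≡ sh x f y
sh-+ k x y f = cong₂ _*ℤ_ (choose-iff (k + x ≤? k + y) (x ≤? y) (ℕP.+-cancelˡ-≤ k x y) (ℕP.+-monoʳ-≤ k))
                          (cong f (ℕP.[m+n]∸[m+o]≡n∸o k y x))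

mono-⊛ : ∀ k f N → (mono k ⊛ f) N ≡ sh k f N
mono-⊛ k f N = by-cases (k ≤? N)
  where
  by-cases : Dec (k ≤ N) → (mono k ⊛ f) N ≡ sh k f N
  by-cases (yes k≤N) = trans (sum0-single N k k≤N (λ i _ i≢k → 𝟙-zeroˡ (k ≟ i) _ (i≢k ∘ sym)))
                             (trans (𝟙-unitˡ (k ≟ k) _ refl) (sym (𝟙-unitˡ (k ≤? N) _ k≤N)))
  by-cases (no k≰N)  = trans (sum0-zero N (λ i i≤N →
                               𝟙-zeroˡ (k ≟ i) _ (λ k≡i → k≰N (subst (_≤ N) (sym k≡i) i≤N))))
                             (sym (𝟙-zeroˡ (k ≤? N) _ k≰N))

⊛-congˡ : ∀ {f f′ : PS} g N → (∀ i → f i ≡ f′ i) → (f ⊛ g) N ≡ (f′ ⊛ g) N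
⊛-congˡ g N f≗f′ = sum0-cong N (λ i _ → cong (_*ℤ g (N ∸ i)) (f≗f′ i))

sh-⊛ : ∀ k f g N → (sh k f ⊛ g) N ≡ sh k (f ⊛ g) N
sh-⊛ zero    f g N = trans (⊛-congˡ g N (λ i → ℤP.*-identityˡ (f i))) (sym (ℤP.*-identityˡ ((f ⊛ g) N)))
sh-⊛ (suc k) f g zero = trans (ℤP.*-zeroˡ (g 0)) (sym (ℤP.*-zeroˡ ((f ⊛ g) 0)))
sh-⊛ (suc k) f g (suc N) = begin
  (sh (suc k) f ⊛ g) (suc N)
    ≡⟨ sum0-suc N (λ i → sh (suc k) f i *ℤ g (suc N ∸ i)) ⟩
  (+ 0 *ℤ f 0) *ℤ g (suc N) +ℤ sum0 N (λ i → sh (suc k) f (suc i) *ℤ g (N ∸ i))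
    ≡⟨ cong₂ _+ℤ_ (ℤP.*-zeroˡ (g (suc N))) (⊛-congˡ g N (λ i → sh-+ 1 k i f)) ⟩
  + 0 +ℤ (sh k f ⊛ g) N
    ≡⟨ ℤP.+-identityˡ _ ⟩
  (sh k f ⊛ g) N
    ≡⟨ sh-⊛ k f g N ⟩
  sh k (f ⊛ g) N
    ≡⟨ sh-+ 1 k N (f ⊛ g) ⟨
  sh (suc k) (f ⊛ g) (suc N) ∎
  where open ≡-Reasoning

∣-as-sum : ∀ g T x → 1 ≤ g → x ≤ T → 𝟙 (g ∣? x) ≡ sum0 T (λ t → 𝟙 (g * t ≟ x))
∣-as-sum g@(suc _) T x _ x≤T = by-cases (g ∣? x)
  where
  by-cases : Dec (g ∣ x) → 𝟙 (g ∣? x) ≡ sum0 T (λ t → 𝟙 (g * t ≟ x))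
  by-cases (yes g∣x@(divides q x≡qg)) =
    trans (choose-yes (g ∣? x) g∣x)
          (sym (trans (sum0-single T q q≤T (λ t _ t≢q → choose-no (g * t ≟ x) (t≢q ∘ cancel)))
                      (choose-yes (g * q ≟ x) (trans (ℕP.*-comm g q) (sym x≡qg)))))
    where
    q≤T : q ≤ T
    q≤T = ℕP.≤-trans (ℕP.m≤m*n q g) (subst (_≤ T) x≡qg x≤T)
    cancel : ∀ {t} → g * t ≡ x → t ≡ q
    cancel gt≡x = ℕP.*-cancelˡ-≡ _ q g (trans gt≡x (trans x≡qg (ℕP.*-comm q g)))
  by-cases (no g∤x) =
    trans (choose-no (g ∣? x) g∤x)
          (sym (sum0-zero T (λ t _ → choose-no (g * t ≟ x) (λ gt≡x → g∤x (divides t (trans (sym gt≡x) (ℕP.*-comm g t)))))))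

sh-as-sum : ∀ x L (C : PS) → sum0 L (λ i → C i *ℤ 𝟙 (x ≟ L ∸ i)) ≡ sh x C L
sh-as-sum x L C = by-cases (x ≤? L)
  where
  by-cases : Dec (x ≤ L) → sum0 L (λ i → C i *ℤ 𝟙 (x ≟ L ∸ i)) ≡ sh x C L
  by-cases (yes x≤L) =
    trans (sum0-single L (L ∸ x) (ℕP.m∸n≤m L x) off-diagonal)
          (trans (𝟙-unitʳ (x ≟ L ∸ (L ∸ x)) _ (sym (ℕP.m∸[m∸n]≡n x≤L)))
                 (sym (𝟙-unitˡ (x ≤? L) _ x≤L)))
    where
    off-diagonal : ∀ i → i ≤ L → i ≢ L ∸ x → C i *ℤ 𝟙 (x ≟ L ∸ i) ≡ + 0
    off-diagonal i i≤L i≢ = 𝟙-zeroʳ (x ≟ L ∸ i) (C i)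
      (λ x≡ → i≢ (trans (sym (ℕP.m∸[m∸n]≡n i≤L)) (cong (L ∸_) (sym x≡))))
  by-cases (no x≰L) =
    trans (sum0-zero L (λ i _ → 𝟙-zeroʳ (x ≟ L ∸ i) (C i) (λ x≡ → x≰L (subst (_≤ L) (sym x≡) (ℕP.m∸n≤m L i)))))
          (sym (𝟙-zeroˡ (x ≤? L) _ x≰L))

-- Geometric series: C/(1 - q^g) = Σ_{t ≥ 0} q^{g t} C, where the terms with
-- t > L do not contribute to the coefficient of q^L.
geom-expand : ∀ g T L (C : PS) → 1 ≤ g → L ≤ T → (C ⊛ geom g) L ≡ sum0 T (λ t → sh (g * t) C L)
geom-expand g T L C 1≤g L≤T = begin
  sum0 L (λ i → C i *ℤ geom g (L ∸ i))
    ≡⟨ sum0-cong L (λ i _ → cong (C i *ℤ_) (∣-as-sum g T (L ∸ i) 1≤g (ℕP.≤-trans (ℕP.m∸n≤m L i) L≤T))) ⟩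
  sum0 L (λ i → C i *ℤ sum0 T (λ t → 𝟙 (g * t ≟ L ∸ i)))
    ≡⟨ sum0-cong L (λ i _ → sum0-*ˡ T (C i) _) ⟩
  sum0 L (λ i → sum0 T (λ t → C i *ℤ 𝟙 (g * t ≟ L ∸ i)))
    ≡⟨ sum0-swap L T _ ⟩
  sum0 T (λ t → sum0 L (λ i → C i *ℤ 𝟙 (g * t ≟ L ∸ i)))
    ≡⟨ sum0-cong T (λ t _ → sh-as-sum (g * t) L C) ⟩
  sum0 T (λ t → sh (g * t) C L) ∎
  where open ≡-Reasoning

geom-expand-sh : ∀ k g T M (C : PS) → 1 ≤ g → M ≤ k + T →
                 sh k (C ⊛ geom g) M ≡ sum0 T (λ t → sh (k + g * t) C M)
geom-expand-sh k g T M C 1≤g M≤k+T = by-cases (k ≤? M)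
  where
  by-cases : Dec (k ≤ M) → sh k (C ⊛ geom g) M ≡ sum0 T (λ t → sh (k + g * t) C M)
  by-cases (yes k≤M) with ℕP.m≤n⇒∃[o]m+o≡n k≤M
  ... | L , refl = begin
    sh k (C ⊛ geom g) (k + L)             ≡⟨ sh-at k (C ⊛ geom g) L ⟩
    (C ⊛ geom g) L                        ≡⟨ geom-expand g T L C 1≤g (ℕP.+-cancelˡ-≤ k L T M≤k+T) ⟩
    sum0 T (λ t → sh (g * t) C L)         ≡⟨ sum0-cong T (λ t _ → sh-+ k (g * t) L C) ⟨
    sum0 T (λ t → sh (k + g * t) C (k + L)) ∎
    where open ≡-Reasoning
  by-cases (no k≰M) =
    trans (sh-vanish k (C ⊛ geom g) M (ℕP.≰⇒> k≰M))
          (sym (sum0-zero T (λ t _ → sh-vanish (k + g * t) C M (ℕP.<-≤-trans (ℕP.≰⇒> k≰M) (ℕP.m≤m+n k (g * t))))))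

invPoch² : ℕ → PS
invPoch² m = invPoch m ⊛ invPoch m

termB-sh : ∀ c m N → termB c m N ≡ sh (m * m + c * m) (invPoch² m) N
termB-sh c m N = trans (⊛-congˡ (invPoch m) N (mono-⊛ (m * m + c * m) (invPoch m)))
                       (sh-⊛ (m * m + c * m) (invPoch m) (invPoch m) N)

termBh-sh : ∀ c m N → termBh c m N ≡ sh (m * m + c * m) (invPoch² m ⊛ geom (c * m)) N
termBh-sh c m N = trans (⊛-congˡ (geom (c * m)) N (termB-sh c m))
                        (sh-⊛ (m * m + c * m) (invPoch² m) (geom (c * m)) N)

order-bound : ∀ c m N → 1 ≤ m → N < c → N < m * m + c * m
order-bound c m@(suc _) N _ N<c = ℕP.<-≤-trans N<c (ℕP.≤-trans (ℕP.m≤m*n c m) (ℕP.m≤n+m (c * m) (m * m)))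

b-vanish : ∀ c N → N < c → b c N ≡ + 0
b-vanish c N N<c = sum1-zero N (λ m 1≤m _ →
  trans (termB-sh c m N) (sh-vanish _ (invPoch² m) N (order-bound c m N 1≤m N<c)))

bh-vanish : ∀ c N → N < c → bh c N ≡ + 0
bh-vanish c N N<c = sum1-zero N (λ m 1≤m _ →
  trans (termBh-sh c m N) (sh-vanish _ (invPoch² m ⊛ geom (c * m)) N (order-bound c m N 1≤m N<c)))

-- The exponent of the m-th summand of B_{c(t+1)}, split as in q^{m²+cm} · (q^{cm})^t.
exponent-split : ∀ m c t → m * m + (c * suc t) * m ≡ (m * m + c * m) + (c * m) * t
exponent-split = +-*-Solver.solve 3 (λ m c t → m :* m :+ (c :* (con 1 :+ t)) :* m := (m :* m :+ c :* m) :+ (c :* m) :* t) refl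
  where open +-*-Solver

summand-identity : ∀ c m N → 1 ≤ c → 1 ≤ m → 1 ≤ N → sum1 N (λ j → termB (c * j) m N) ≡ termBh c m N
summand-identity c@(suc _) m@(suc _) N@(suc N′) _ _ _ = begin
  sum1 N (λ j → termB (c * j) m N)
    ≡⟨ sum1-sum0 N′ (λ j → termB (c * j) m N) ⟩
  sum0 N′ (λ t → termB (c * suc t) m N)
    ≡⟨ sum0-cong N′ (λ t _ → trans (termB-sh (c * suc t) m N) (cong (λ e → sh e (invPoch² m) N) (exponent-split m c t))) ⟩
  sum0 N′ (λ t → sh (K + (c * m) * t) (invPoch² m) N)
    ≡⟨ geom-expand-sh K (c * m) N′ N (invPoch² m) (s≤s z≤n) (ℕP.+-monoˡ-≤ N′ {1} {K} (s≤s z≤n)) ⟨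
  sh K (invPoch² m ⊛ geom (c * m)) N
    ≡⟨ termBh-sh c m N ⟨
  termBh c m N ∎
  where
  open ≡-Reasoning
  K : ℕ
  K = m * m + c * m

bh-as-sum : ∀ c N → 1 ≤ c → sum1 N (λ j → b (c * j) N) ≡ bh c N
bh-as-sum c N 1≤c = trans (sum1-swap N N (λ j m → termB (c * j) m N))
                          (sum1-cong N (λ m 1≤m m≤N → summand-identity c m N 1≤c 1≤m (ℕP.≤-trans 1≤m m≤N)))

prime>1 : ∀ {p} → Prime p → 1 < p
prime>1 {p} pp = nonTrivial⇒n>1 p {{prime⇒nonTrivial pp}}

-- q ≤ q p for a prime p (the instance argument hides p ≠ 0).
≤-*prime : ∀ {p} q → Prime p → q ≤ q * p
≤-*prime {p} q pp = ℕP.m≤m*n q p {{prime⇒nonZero pp}}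

prime∤⇒coprime : ∀ {p d} → Prime p → ¬ p ∣ d → Coprime p d
prime∤⇒coprime pp p∤d (i∣p , i∣d) with prime⇒irreducible pp i∣p
... | inj₁ i≡1 = i≡1
... | inj₂ refl = ⊥-elim (p∤d i∣d)

prime-∣-*prime : ∀ {p r} q → Prime p → Prime r → r ≢ p → r ∣ q * p → r ∣ q
prime-∣-*prime q pp pr r≢p r∣qp with euclidsLemma q _ pr r∣qp
... | inj₁ r∣q = r∣q
... | inj₂ r∣p with prime⇒irreducible pp r∣p
...   | inj₁ refl = ⊥-elim (ℕP.<-irrefl refl (prime>1 pr))
...   | inj₂ r≡p = ⊥-elim (r≢p r≡p)

squareful : ℕ → Bool
squareful n = hasSquareFactorUpTo n n

hasSquareFactorUpTo-sound : ∀ k n → hasSquareFactorUpTo k n ≡ true → Σ ℕ (λ d → 2 ≤ d × d * d ∣ n)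
hasSquareFactorUpTo-sound (suc (suc k)) n flag =
  [ hasSquareFactorUpTo-sound (suc k) n
  , (λ d²∣n → suc (suc k) , s≤s (s≤s z≤n) , isYes-sound ((suc (suc k) * suc (suc k)) ∣? n) d²∣n)
  ]′ (∨-true (hasSquareFactorUpTo (suc k) n) flag)
  where
  ∨-true : ∀ x {y} → x ∨ y ≡ true → x ≡ true ⊎ y ≡ true
  ∨-true true  _ = inj₁ refl
  ∨-true false e = inj₂ e

hasSquareFactorUpTo-complete : ∀ k n d → 2 ≤ d → d ≤ k → d * d ∣ n → hasSquareFactorUpTo k n ≡ true
hasSquareFactorUpTo-complete (suc zero) n (suc (suc d)) (s≤s (s≤s _)) (s≤s ()) _
hasSquareFactorUpTo-complete (suc (suc k)) n d 2≤d d≤k d²∣n =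
  [ (λ d<k → cong (_∨ isYes ((suc (suc k) * suc (suc k)) ∣? n))
                  (hasSquareFactorUpTo-complete (suc k) n d 2≤d (ℕP.≤-pred d<k) d²∣n))
  , (λ { refl → trans (cong (hasSquareFactorUpTo (suc k) n ∨_) (isYes-complete ((d * d) ∣? n) d²∣n))
                      (BoolP.∨-zeroʳ _) })
  ]′ (ℕP.m≤n⇒m<n∨m≡n d≤k)

-- A square factor d² with d ≥ 2 sets the flag of n ≥ 1 (d ≤ n bounds the search).
squareful-complete : ∀ n d → 1 ≤ n → 2 ≤ d → d * d ∣ n → squareful n ≡ true
squareful-complete n@(suc _) d@(suc _) _ 2≤d d²∣n =
  hasSquareFactorUpTo-complete n n d 2≤d (ℕP.≤-trans (ℕP.m≤m*n d d) (∣⇒≤ d²∣n)) d²∣n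

squareful-*prime-∣ : ∀ {p} q → Prime p → p ∣ q → 1 ≤ q → squareful (q * p) ≡ true
squareful-*prime-∣ {p} q pp p∣q 1≤q =
  squareful-complete (q * p) p (ℕP.≤-trans 1≤q (≤-*prime q pp)) (prime>1 pp) (*-pres-∣ p∣q ∣-refl)

squareful-*prime-∤ : ∀ {p} q → Prime p → ¬ p ∣ q → 1 ≤ q → squareful (q * p) ≡ squareful q
squareful-*prime-∤ {p} q pp p∤q 1≤q = Bool-ext from-qp to-qp
  where
  instance
    p≢0 : NonZero p
    p≢0 = prime⇒nonZero pp
  to-qp : squareful q ≡ true → squareful (q * p) ≡ true
  to-qp flag with hasSquareFactorUpTo-sound q q flag
  ... | d , 2≤d , d²∣q = squareful-complete (q * p) d (ℕP.≤-trans 1≤q (≤-*prime q pp)) 2≤d (∣m⇒∣m*n p d²∣q)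
  from-qp : squareful (q * p) ≡ true → squareful q ≡ true
  from-qp flag with hasSquareFactorUpTo-sound (q * p) (q * p) flag
  ... | d , 2≤d , d²∣qp with p ∣? d
  ...   | yes p∣d = ⊥-elim (p∤q (*-cancelʳ-∣ p (∣-trans (*-pres-∣ p∣d p∣d) d²∣qp)))
  ...   | no p∤d  = squareful-complete q d 1≤q 2≤d (coprime-divisor d²⊥p (subst (d * d ∣_) (ℕP.*-comm q p) d²∣qp))
    where
    p∤d² : ¬ p ∣ d * d
    p∤d² p∣d² = [ p∤d , p∤d ]′ (euclidsLemma d d pp p∣d²)
    d²⊥p : Coprime (d * d) p
    d²⊥p = Coprime.sym (prime∤⇒coprime pp p∤d²)

isPrimeDivisor : ℕ → ℕ → ℕ
isPrimeDivisor r n = choose (ι (r ∣? n)) 0 (prime? r)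

primeDivCountUpTo-suc : ∀ k n → primeDivCountUpTo (suc k) n ≡ primeDivCountUpTo k n + isPrimeDivisor (suc k) n
primeDivCountUpTo-suc k n with prime? (suc k)
... | yes _ = refl
... | no _  = refl

isPrimeDivisor-yes : ∀ r n → Prime r → r ∣ n → isPrimeDivisor r n ≡ 1
isPrimeDivisor-yes r n pr r∣n = trans (choose-yes (prime? r) pr) (choose-yes (r ∣? n) r∣n)

isPrimeDivisor-no : ∀ r n → ¬ r ∣ n → isPrimeDivisor r n ≡ 0
isPrimeDivisor-no r n r∤n = by-cases (prime? r)
  where
  by-cases : (d : Dec (Prime r)) → choose (ι (r ∣? n)) 0 d ≡ 0
  by-cases (yes _) = choose-no (r ∣? n) r∤n
  by-cases (no _)  = refl

isPrimeDivisor-cong : ∀ r n n′ → (Prime r → r ∣ n → r ∣ n′) → (Prime r → r ∣ n′ → r ∣ n) →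
                      isPrimeDivisor r n ≡ isPrimeDivisor r n′
isPrimeDivisor-cong r n n′ to from = by-cases (prime? r)
  where
  by-cases : (d : Dec (Prime r)) → choose (ι (r ∣? n)) 0 d ≡ choose (ι (r ∣? n′)) 0 d
  by-cases (yes pr) = choose-iff (r ∣? n) (r ∣? n′) (to pr) (from pr)
  by-cases (no _)   = refl

primeDivCountUpTo-*prime : ∀ {p} q → Prime p → ¬ p ∣ q → ∀ k →
                           primeDivCountUpTo k (q * p) ≡ primeDivCountUpTo k q + ι (p ≤? k)
primeDivCountUpTo-*prime {p} q pp p∤q zero =
  sym (choose-no (p ≤? 0) (ℕP.<⇒≱ (ℕP.<-trans (s≤s z≤n) (prime>1 pp))))
primeDivCountUpTo-*prime {p} q pp p∤q (suc k) = begin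
  primeDivCountUpTo (suc k) (q * p)
    ≡⟨ primeDivCountUpTo-suc k (q * p) ⟩
  primeDivCountUpTo k (q * p) + isPrimeDivisor (suc k) (q * p)
    ≡⟨ cong (_+ isPrimeDivisor (suc k) (q * p)) (primeDivCountUpTo-*prime q pp p∤q k) ⟩
  primeDivCountUpTo k q + ι (p ≤? k) + isPrimeDivisor (suc k) (q * p)
    ≡⟨ new-term (suc k ≟ p) ⟩
  primeDivCountUpTo k q + isPrimeDivisor (suc k) q + ι (p ≤? suc k)
    ≡⟨ cong (_+ ι (p ≤? suc k)) (primeDivCountUpTo-suc k q) ⟨
  primeDivCountUpTo (suc k) q + ι (p ≤? suc k) ∎
  where
  open ≡-Reasoning
  C : ℕ
  C = primeDivCountUpTo k q
  -- Either k+1 = p, which is counted for q p but not for q, or the k+1-st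
  -- terms agree and p ≤ k ⇔ p ≤ k+1.
  new-term : Dec (suc k ≡ p) →
             C + ι (p ≤? k) + isPrimeDivisor (suc k) (q * p) ≡ C + isPrimeDivisor (suc k) q + ι (p ≤? suc k)
  new-term (yes refl) = cong₂ (λ x y → C + x + y)
    (trans (choose-no (p ≤? k) (ℕP.<-irrefl refl)) (sym (isPrimeDivisor-no p q p∤q)))
    (trans (isPrimeDivisor-yes p (q * p) pp (n∣m*n q)) (sym (choose-yes (p ≤? suc k) ℕP.≤-refl)))
  new-term (no k+1≢p) = trans
    (cong₂ (λ x y → C + x + y)
      (choose-iff (p ≤? k) (p ≤? suc k) ℕP.m≤n⇒m≤1+n
                  (λ p≤k+1 → ℕP.≤-pred (ℕP.≤∧≢⇒< p≤k+1 (k+1≢p ∘ sym))))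
      (isPrimeDivisor-cong (suc k) (q * p) q (λ pr → prime-∣-*prime q pp pr k+1≢p) (λ _ → ∣m⇒∣m*n p)))
    (xy∙z≈xz∙y C (ι (p ≤? suc k)) (isPrimeDivisor (suc k) q))

-- No prime beyond n divides n ≥ 1, so counting up to any k ≥ n counts them all.
primeDivCountUpTo-stable : ∀ n t → 1 ≤ n → primeDivCountUpTo (n + t) n ≡ primeDivCountUpTo n n
primeDivCountUpTo-stable n zero    _ = cong (λ k → primeDivCountUpTo k n) (ℕP.+-identityʳ n)
primeDivCountUpTo-stable n@(suc _) (suc t) 1≤n = begin
  primeDivCountUpTo (n + suc t) n
    ≡⟨ cong (λ k → primeDivCountUpTo k n) (ℕP.+-suc n t) ⟩
  primeDivCountUpTo (suc (n + t)) n
    ≡⟨ primeDivCountUpTo-suc (n + t) n ⟩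
  primeDivCountUpTo (n + t) n + isPrimeDivisor (suc (n + t)) n
    ≡⟨ cong₂ _+_ (primeDivCountUpTo-stable n t 1≤n)
                 (isPrimeDivisor-no (suc (n + t)) n (ℕP.<⇒≱ (s≤s (ℕP.m≤m+n n t)) ∘ ∣⇒≤)) ⟩
  primeDivCountUpTo n n + 0
    ≡⟨ ℕP.+-identityʳ _ ⟩
  primeDivCountUpTo n n ∎
  where open ≡-Reasoning

ω : ℕ → ℕ
ω n = primeDivCountUpTo n n

ω-*prime : ∀ {p} q → Prime p → ¬ p ∣ q → 1 ≤ q → ω (q * p) ≡ suc (ω q)
ω-*prime {p} q pp p∤q 1≤q with ℕP.m≤n⇒∃[o]m+o≡n (≤-*prime q pp)
... | t , q+t≡qp = begin
  primeDivCountUpTo (q * p) (q * p)        ≡⟨ primeDivCountUpTo-*prime q pp p∤q (q * p) ⟩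
  primeDivCountUpTo (q * p) q + ι (p ≤? q * p)
    ≡⟨ cong₂ _+_ (trans (cong (λ k → primeDivCountUpTo k q) (sym q+t≡qp)) (primeDivCountUpTo-stable q t 1≤q))
                 (choose-yes (p ≤? q * p) (ℕP.m≤n*m p q {{>-nonZero 1≤q}})) ⟩
  ω q + 1                                  ≡⟨ ℕP.+-comm (ω q) 1 ⟩
  suc (ω q) ∎
  where open ≡-Reasoning

parity-suc : ∀ x → isYes (2 ∣? suc x) ≡ not (isYes (2 ∣? x))
parity-suc zero          = refl
parity-suc (suc zero)    = refl
parity-suc (suc (suc x)) = trans (parity-+2 (suc x)) (trans (parity-suc x) (cong not (sym (parity-+2 x))))
  where
  parity-+2 : ∀ y → isYes (2 ∣? 2 + y) ≡ isYes (2 ∣? y)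
  parity-+2 y = Bool-ext (λ e → isYes-complete (2 ∣? y) (∣m+n∣m⇒∣n (isYes-sound (2 ∣? 2 + y) e) ∣-refl))
                         (λ e → isYes-complete (2 ∣? 2 + y) (∣m∣n⇒∣m+n ∣-refl (isYes-sound (2 ∣? y) e)))

μ-formula : Bool → ℕ → ℤ
μ-formula s k = if s then + 0 else (if isYes (2 ∣? k) then + 1 else -ℤ (+ 1))

μ-unfold : ∀ n → 1 ≤ n → μ n ≡ μ-formula (squareful n) (ω n)
μ-unfold (suc _) _ = refl

μ-formula-suc : ∀ s k → μ-formula s (suc k) ≡ -ℤ μ-formula s k
μ-formula-suc true  k = refl
μ-formula-suc false k rewrite parity-suc k with isYes (2 ∣? k)
... | true  = refl
... | false = refl

μ-*prime-∣ : ∀ {p} q → Prime p → p ∣ q → 1 ≤ q → μ (q * p) ≡ + 0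
μ-*prime-∣ {p} q pp p∣q 1≤q =
  trans (μ-unfold (q * p) (ℕP.≤-trans 1≤q (≤-*prime q pp)))
        (cong (λ s → μ-formula s (ω (q * p))) (squareful-*prime-∣ q pp p∣q 1≤q))

μ-*prime-∤ : ∀ {p} q → Prime p → ¬ p ∣ q → 1 ≤ q → μ (q * p) ≡ -ℤ μ q
μ-*prime-∤ {p} q pp p∤q 1≤q = begin
  μ (q * p)
    ≡⟨ μ-unfold (q * p) (ℕP.≤-trans 1≤q (≤-*prime q pp)) ⟩
  μ-formula (squareful (q * p)) (ω (q * p))
    ≡⟨ cong₂ μ-formula (squareful-*prime-∤ q pp p∤q 1≤q) (ω-*prime q pp p∤q 1≤q) ⟩
  μ-formula (squareful q) (suc (ω q))
    ≡⟨ μ-formula-suc (squareful q) (ω q) ⟩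
  -ℤ μ-formula (squareful q) (ω q)
    ≡⟨ cong -ℤ_ (μ-unfold q 1≤q) ⟨
  -ℤ μ q ∎
  where open ≡-Reasoning

prime-factor : ∀ k → Σ ℕ (λ p → Prime p × p ∣ suc (suc k))
prime-factor k with factorise (suc (suc k))
... | record { factors = [] ; isFactorisation = () }
... | record { factors = p ∷ ps ; isFactorisation = m≡p*ps ; factorsPrime = pp ∷ _ } =
  p , pp , subst (p ∣_) (sym m≡p*ps) (m∣m*n _)

factor-pos : ∀ q p m → 1 ≤ m → m ≡ q * p → 1 ≤ q
factor-pos zero    p .0 () refl
factor-pos (suc q) p m  _  _ = s≤s z≤n

-- Dilation by p of a sequence V supported on 1..n: dilate n p V (i p) = V i, and
-- dilate n p V j = 0 when p ∤ j.
dilate : ℕ → ℕ → (ℕ → ℤ) → ℕ → ℤ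
dilate n p V j = sum1 n (λ i → 𝟙 (j ≟ i * p) *ℤ V i)

dilate-∤ : ∀ n p V j → ¬ p ∣ j → dilate n p V j ≡ + 0
dilate-∤ n p V j p∤j = sum1-zero n (λ i _ _ → 𝟙-zeroˡ (j ≟ i * p) (V i) (λ j≡ip → p∤j (divides i j≡ip)))

dilate-at : ∀ n p V j q → Prime p → 1 ≤ j → j ≤ n → j ≡ q * p → dilate n p V j ≡ V q
dilate-at n p V j q pp 1≤j j≤n j≡qp =
  trans (sum1-single n q (factor-pos q p j 1≤j j≡qp) (ℕP.≤-trans (≤-*prime q pp) (subst (_≤ n) j≡qp j≤n)) off-q)
        (𝟙-unitˡ (j ≟ q * p) (V q) j≡qp)
  where
  off-q : ∀ i → 1 ≤ i → i ≤ n → i ≢ q → 𝟙 (j ≟ i * p) *ℤ V i ≡ + 0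
  off-q i _ _ i≢q = 𝟙-zeroˡ (j ≟ i * p) (V i)
    (λ j≡ip → i≢q (ℕP.*-cancelʳ-≡ i q p {{prime⇒nonZero pp}} (trans (sym j≡ip) j≡qp)))

sum1-dilate : ∀ n p V → Prime p → (∀ i → n < i * p → V i ≡ + 0) → sum1 n (dilate n p V) ≡ sum1 n V
sum1-dilate n p V pp V-small = trans (sum1-swap n n (λ j i → 𝟙 (j ≟ i * p) *ℤ V i)) (sum1-cong n column)
  where
  column : ∀ i → 1 ≤ i → i ≤ n → sum1 n (λ j → 𝟙 (j ≟ i * p) *ℤ V i) ≡ V i
  column i 1≤i _ with i * p ≤? n
  ... | yes ip≤n = trans (sum1-single n (i * p) (ℕP.≤-trans 1≤i (≤-*prime i pp)) ip≤n
                           (λ j _ _ j≢ip → 𝟙-zeroˡ (j ≟ i * p) (V i) j≢ip))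
                         (𝟙-unitˡ (i * p ≟ i * p) (V i) refl)
  ... | no ip≰n  = trans (sum1-zero n (λ j _ _ → trans (cong (𝟙 (j ≟ i * p) *ℤ_) Vi≡0) (ℤP.*-zeroʳ (𝟙 (j ≟ i * p)))))
                         (sym Vi≡0)
    where
    Vi≡0 : V i ≡ + 0
    Vi≡0 = V-small i (ℕP.≰⇒> ip≰n)

-- For m = m′ p with p prime, the divisors d of m with p ∤ d cancel against the
-- divisors d p (with μ(d p) = -μ(d)); divisors divisible by p² have μ = 0.
module CancelAlongPrime (n m′ p : ℕ) (pp : Prime p) (1≤m′ : 1 ≤ m′) (m′p≤n : m′ * p ≤ n) where

  instance
    p≢0 : NonZero p
    p≢0 = prime⇒nonZero pp

  -- The divisor terms coprime to p.
  V : ℕ → ℤ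
  V i = choose (+ 0) (μ i *ℤ 𝟙 (i ∣? m′)) (p ∣? i)

  -- V is supported on divisors of m′, so it vanishes where i p > n ≥ m′ p.
  V-small : ∀ i → n < i * p → V i ≡ + 0
  V-small i n<ip with p ∣? i
  ... | yes _ = refl
  ... | no _  = 𝟙-zeroʳ (i ∣? m′) (μ i) (λ i∣m′ →
                  ℕP.<⇒≱ n<ip (ℕP.≤-trans (ℕP.*-monoˡ-≤ p (∣⇒≤ {{>-nonZero 1≤m′}} i∣m′)) m′p≤n))

  term-split : ∀ j → 1 ≤ j → j ≤ n → μ j *ℤ 𝟙 (j ∣? m′ * p) ≡ V j -ℤ dilate n p V j
  term-split j 1≤j j≤n with p ∣? j
  ... | no p∤j = begin
    μ j *ℤ 𝟙 (j ∣? m′ * p) ≡⟨ cong (μ j *ℤ_) (choose-iff (j ∣? m′ * p) (j ∣? m′) drop-p (∣m⇒∣m*n p)) ⟩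
    μ j *ℤ 𝟙 (j ∣? m′)     ≡⟨ ℤP.+-identityʳ _ ⟨
    μ j *ℤ 𝟙 (j ∣? m′) -ℤ + 0 ≡⟨ cong (λ x → μ j *ℤ 𝟙 (j ∣? m′) -ℤ x) (dilate-∤ n p V j p∤j) ⟨
    μ j *ℤ 𝟙 (j ∣? m′) -ℤ dilate n p V j ∎
    where
    open ≡-Reasoning
    drop-p : j ∣ m′ * p → j ∣ m′
    drop-p j∣m′p = coprime-divisor (Coprime.sym (prime∤⇒coprime pp p∤j)) (subst (j ∣_) (ℕP.*-comm m′ p) j∣m′p)
  ... | yes (divides q j≡qp) rewrite j≡qp = begin
    μ (q * p) *ℤ 𝟙 (q * p ∣? m′ * p)
      ≡⟨ cong (μ (q * p) *ℤ_) (choose-iff (q * p ∣? m′ * p) (q ∣? m′) (*-cancelʳ-∣ p) (*-monoˡ-∣ p)) ⟩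
    μ (q * p) *ℤ 𝟙 (q ∣? m′)
      ≡⟨ paired-term (p ∣? q) ⟩
    -ℤ V q
      ≡⟨ cong -ℤ_ (dilate-at n p V (q * p) q pp 1≤j j≤n refl) ⟨
    -ℤ dilate n p V (q * p)
      ≡⟨ ℤP.+-identityˡ _ ⟨
    + 0 -ℤ dilate n p V (q * p) ∎
    where
    open ≡-Reasoning
    1≤q : 1 ≤ q
    1≤q = factor-pos q p (q * p) 1≤j refl
    paired-term : Dec (p ∣ q) → μ (q * p) *ℤ 𝟙 (q ∣? m′) ≡ -ℤ V q
    paired-term (yes p∣q) = trans (cong (_*ℤ 𝟙 (q ∣? m′)) (μ-*prime-∣ q pp p∣q 1≤q))
                                  (cong -ℤ_ (sym (choose-yes (p ∣? q) p∣q)))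
    paired-term (no p∤q)  = begin
      μ (q * p) *ℤ 𝟙 (q ∣? m′)  ≡⟨ cong (_*ℤ 𝟙 (q ∣? m′)) (μ-*prime-∤ q pp p∤q 1≤q) ⟩
      -ℤ μ q *ℤ 𝟙 (q ∣? m′)     ≡⟨ ℤP.neg-distribˡ-* (μ q) (𝟙 (q ∣? m′)) ⟨
      -ℤ (μ q *ℤ 𝟙 (q ∣? m′))   ≡⟨ cong -ℤ_ (choose-no (p ∣? q) p∤q) ⟨
      -ℤ V q ∎

  divisor-sum-zero : sum1 n (λ j → μ j *ℤ 𝟙 (j ∣? m′ * p)) ≡ + 0
  divisor-sum-zero = begin
    sum1 n (λ j → μ j *ℤ 𝟙 (j ∣? m′ * p))     ≡⟨ sum1-cong n term-split ⟩
    sum1 n (λ j → V j +ℤ -ℤ dilate n p V j)   ≡⟨ sum1-+ n V (λ j → -ℤ dilate n p V j) ⟩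
    sum1 n V +ℤ sum1 n (λ j → -ℤ dilate n p V j) ≡⟨ cong (sum1 n V +ℤ_) (sum1-neg n (dilate n p V)) ⟩
    sum1 n V -ℤ sum1 n (dilate n p V)         ≡⟨ cong (λ x → sum1 n V -ℤ x) (sum1-dilate n p V pp V-small) ⟩
    sum1 n V -ℤ sum1 n V                      ≡⟨ ℤP.+-inverseʳ (sum1 n V) ⟩
    + 0 ∎
    where open ≡-Reasoning

μ-divisor-sum : ∀ m n → 1 ≤ m → m ≤ n → sum1 n (λ j → μ j *ℤ 𝟙 (j ∣? m)) ≡ 𝟙 (m ≟ 1)
μ-divisor-sum (suc zero) n _ 1≤n =
  trans (sum1-single n 1 (s≤s z≤n) 1≤n (λ j _ _ j≢1 → 𝟙-zeroʳ (j ∣? 1) (μ j) (j≢1 ∘ ∣1⇒≡1))) refl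
μ-divisor-sum m@(suc (suc k)) n 1≤m m≤n with prime-factor k
... | p , pp , divides m′ m≡m′p = subst (λ x → sum1 n (λ j → μ j *ℤ 𝟙 (j ∣? x)) ≡ 𝟙 (m ≟ 1)) (sym m≡m′p)
  (CancelAlongPrime.divisor-sum-zero n m′ p pp (factor-pos m′ p m 1≤m m≡m′p) (subst (_≤ n) m≡m′p m≤n))

module MöbiusInversion (n : ℕ) (f : ℕ → ℤ) (f-small : ∀ m → n < m → f m ≡ + 0) where

  f-as-sum : ∀ x → 1 ≤ x → f x ≡ sum1 n (λ m → f m *ℤ 𝟙 (m ≟ x))
  f-as-sum x 1≤x with x ≤? n
  ... | yes x≤n = sym (trans (sum1-single n x 1≤x x≤n (λ m _ _ m≢x → 𝟙-zeroʳ (m ≟ x) (f m) m≢x))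
                             (𝟙-unitʳ (x ≟ x) (f x) refl))
  ... | no x≰n  = trans (f-small x (ℕP.≰⇒> x≰n))
                        (sym (sum1-zero n (λ m _ m≤n → 𝟙-zeroʳ (m ≟ x) (f m) (λ m≡x → x≰n (subst (_≤ n) m≡x m≤n)))))

  count-cofactors : ∀ j m → 1 ≤ j → 1 ≤ m → m ≤ n → sum1 n (λ k → 𝟙 (m ≟ j * k)) ≡ 𝟙 (j ∣? m)
  count-cofactors j m 1≤j 1≤m m≤n with j ∣? m
  ... | yes (divides q m≡qj) =
    trans (sum1-single n q (factor-pos q j m 1≤m m≡qj)
                       (ℕP.≤-trans (ℕP.m≤m*n q j {{>-nonZero 1≤j}}) (subst (_≤ n) m≡qj m≤n))
                       (λ k _ _ k≢q → choose-no (m ≟ j * k) (k≢q ∘ cancel)))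
          (choose-yes (m ≟ j * q) (trans m≡qj (ℕP.*-comm q j)))
    where
    cancel : ∀ {k} → m ≡ j * k → k ≡ q
    cancel m≡jk = ℕP.*-cancelˡ-≡ _ q j {{>-nonZero 1≤j}} (trans (sym m≡jk) (trans m≡qj (ℕP.*-comm q j)))
  ... | no j∤m = sum1-zero n (λ k _ _ → choose-no (m ≟ j * k) (λ m≡jk → j∤m (divides k (trans m≡jk (ℕP.*-comm j k)))))

  μ-weight : ∀ m → 1 ≤ m → m ≤ n → sum1 n (λ j → μ j *ℤ sum1 n (λ k → 𝟙 (m ≟ j * k))) ≡ 𝟙 (m ≟ 1)
  μ-weight m 1≤m m≤n =
    trans (sum1-cong n (λ j 1≤j _ → cong (μ j *ℤ_) (count-cofactors j m 1≤j 1≤m m≤n))) (μ-divisor-sum m n 1≤m m≤n)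

  collect : ∀ m → sum1 n (λ j → sum1 n (λ k → μ j *ℤ (f m *ℤ 𝟙 (m ≟ j * k))))
                  ≡ f m *ℤ sum1 n (λ j → μ j *ℤ sum1 n (λ k → 𝟙 (m ≟ j * k)))
  collect m = sym (trans (sum1-*ˡ n (f m) _)
    (sum1-cong n (λ j _ _ → trans (cong (f m *ℤ_) (sum1-*ˡ n (μ j) _))
                                  (trans (sum1-*ˡ n (f m) _) (sum1-cong n (λ k _ _ → x∙yz≈y∙xz (f m) (μ j) _))))))

  inversion : sum1 n (λ j → μ j *ℤ sum1 n (λ k → f (j * k))) ≡ f 1
  inversion = begin
    sum1 n (λ j → μ j *ℤ sum1 n (λ k → f (j * k)))
      ≡⟨ sum1-cong n (λ j 1≤j _ → cong (μ j *ℤ_)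
                       (sum1-cong n (λ k 1≤k _ → f-as-sum (j * k) (ℕP.*-mono-≤ 1≤j 1≤k)))) ⟩
    sum1 n (λ j → μ j *ℤ sum1 n (λ k → sum1 n (λ m → f m *ℤ 𝟙 (m ≟ j * k))))
      ≡⟨ sum1-cong n (λ j _ _ → trans (sum1-*ˡ n (μ j) _) (sum1-cong n (λ k _ _ → sum1-*ˡ n (μ j) _))) ⟩
    sum1 n (λ j → sum1 n (λ k → sum1 n (λ m → μ j *ℤ (f m *ℤ 𝟙 (m ≟ j * k)))))
      ≡⟨ sum1-cong n (λ j _ _ → sum1-swap n n _) ⟩
    sum1 n (λ j → sum1 n (λ m → sum1 n (λ k → μ j *ℤ (f m *ℤ 𝟙 (m ≟ j * k)))))
      ≡⟨ sum1-swap n n _ ⟩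
    sum1 n (λ m → sum1 n (λ j → sum1 n (λ k → μ j *ℤ (f m *ℤ 𝟙 (m ≟ j * k)))))
      ≡⟨ sum1-cong n (λ m 1≤m m≤n → trans (collect m) (cong (f m *ℤ_) (μ-weight m 1≤m m≤n))) ⟩
    sum1 n (λ m → f m *ℤ 𝟙 (m ≟ 1))
      ≡⟨ f-as-sum 1 ℕP.≤-refl ⟨
    f 1 ∎
    where open ≡-Reasoning

-- j ≤ a j for a ≥ 1, so the terms with j > n have order above n.
≤-scaled : ∀ a j → 1 ≤ a → j ≤ a * j
≤-scaled a j 1≤a = ℕP.m≤n*m j a {{>-nonZero 1≤a}}

bh-series : ∀ a → 1 ≤ a → ∀ n → HasSum (λ j → b (a * j) n) (bh a n)
bh-series a 1≤a n = n , b-beyond , bh-as-sum a n 1≤a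
  where
  b-beyond : ∀ j → n < j → b (a * j) n ≡ + 0
  b-beyond j n<j = b-vanish (a * j) n (ℕP.<-≤-trans n<j (≤-scaled a j 1≤a))

-- Second identity: b_a(n) = Σ_{j ≥ 1} μ(j) b̂_{aj}(n), by Möbius inversion of
-- the first identity applied to f(m) = b_{am}(n).
b-möbius-series : ∀ a → 1 ≤ a → ∀ n → HasSum (λ j → μ j *ℤ bh (a * j) n) (b a n)
b-möbius-series a 1≤a n = n , bh-beyond , (begin
  sum1 n (λ j → μ j *ℤ bh (a * j) n)
    ≡⟨ sum1-cong n (λ j 1≤j _ → cong (μ j *ℤ_) (sym (bh-as-multiples j 1≤j))) ⟩
  sum1 n (λ j → μ j *ℤ sum1 n (λ k → f (j * k)))
    ≡⟨ MöbiusInversion.inversion n f f-small ⟩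
  b (a * 1) n
    ≡⟨ cong (λ c → b c n) (ℕP.*-identityʳ a) ⟩
  b a n ∎)
  where
  open ≡-Reasoning
  f : ℕ → ℤ
  f m = b (a * m) n
  f-small : ∀ m → n < m → f m ≡ + 0
  f-small m n<m = b-vanish (a * m) n (ℕP.<-≤-trans n<m (≤-scaled a m 1≤a))
  bh-beyond : ∀ j → n < j → μ j *ℤ bh (a * j) n ≡ + 0
  bh-beyond j n<j = trans (cong (μ j *ℤ_) (bh-vanish (a * j) n (ℕP.<-≤-trans n<j (≤-scaled a j 1≤a))))
                          (ℤP.*-zeroʳ (μ j))
  bh-as-multiples : ∀ j → 1 ≤ j → sum1 n (λ k → f (j * k)) ≡ bh (a * j) n
  bh-as-multiples j 1≤j = trans (sum1-cong n (λ k _ _ → cong (λ c → b c n) (sym (ℕP.*-assoc a j k))))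
                                (bh-as-sum (a * j) n (ℕP.≤-trans 1≤j (≤-scaled a j 1≤a)))

-- The theorem; its middle part is the second identity, since B and Bh are b and bh
-- read as power series.
theorem2p3 : (a : ℕ) → 1 ≤ a →
    (∀ n → HasSum (λ j → b (a * j) n) (bh a n))
    × PSHasSum (λ n → λ N → μ n *ℤ Bh (a * n) N) (B a)
    × (∀ n → HasSum (λ j → μ j *ℤ bh (a * j) n) (b a n))
theorem2p3 a 1≤a = bh-series a 1≤a , b-möbius-series a 1≤a , b-möbius-series a 1≤a
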